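{- If $\mathrm{H}$ is a reflexive tournament that is endo-trivial, then every homomorphic image of $\mathrm{H}$ with $n$ vertices, where $1<n<|V(\mathrm{H})|$, possesses a double edge.
   Context: A reflexive tournament is a digraph with more than one vertex, a loop at every vertex, and for every two distinct vertices $u,v$ exactly one of $(u,v),(v,u)$ as an edge. A digraph is endo-trivial if each of its endomorphisms (homomorphisms to itself) is an automorphism or a constant map. A homomorphic image of $\mathrm{H}$ is a digraph $\mathrm{H}'$ for which there is a homomorphism $h:\mathrm{H}\to\mathrm{H}'$ that is surjective on vertices and such that for every $(x',y')\in E(\mathrm{H}')$ there is $(x,y)\in E(\mathrm{H})$ with $h(x)=x'$, $h(y)=y'$. A double edge is a pair of distinct vertices $u,v$ with both $(u,v)$ and $(v,u)$ edges. -}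

module Defs where

open import Data.Nat using (ℕ; _<_)
open import Data.Fin using (Fin)
open import Data.Product using (Σ; ∃; _×_; _,_)
open import Data.Sum using (_⊎_)
open import Relation.Nullary using (¬_)
open import Relation.Binary.PropositionalEquality using (_≡_; _≢_)

record Digraph : Set₁ where
  field
    size : ℕ
    E    : Fin size → Fin size → Set
open Digraph public

V : Digraph → Set
V G = Fin (size G)

IsReflexiveTournament : Digraph → Set
IsReflexiveTournament G =
  (1 < size G) ×
  ((u : V G) → E G u u) ×
  ((u v : V G) → u ≢ v →
     (E G u v × ¬ E G v u) ⊎ (E G v u × ¬ E G u v))

IsHom : (G H : Digraph) → (V G → V H) → Set
IsHom G H f = ∀ x y → E G x y → E H (f x) (f y)

IsAutomorphism : (G : Digraph) → (V G → V G) → Set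
IsAutomorphism G f =
  IsHom G G f ×
  Σ (V G → V G) λ g →
    ((x : V G) → g (f x) ≡ x) × ((y : V G) → f (g y) ≡ y) × IsHom G G g

IsConstant : {A B : Set} → (A → B) → Set
IsConstant {A} {B} f = Σ B λ c → (x : A) → f x ≡ c

IsEndoTrivial : Digraph → Set
IsEndoTrivial G =
  (f : V G → V G) → IsHom G G f → IsAutomorphism G f ⊎ IsConstant f

IsHomImageVia : (H H' : Digraph) → (V H → V H') → Set
IsHomImageVia H H' h =
  IsHom H H' h ×
  ((y : V H') → ∃ λ x → h x ≡ y) ×
  ((x' y' : V H') → E H' x' y' →
     ∃ λ x → ∃ λ y → E H x y × h x ≡ x' × h y ≡ y')

IsHomomorphicImage : (H H' : Digraph) → Set
IsHomomorphicImage H H' = Σ (V H → V H') λ h → IsHomImageVia H H' h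

HasDoubleEdge : Digraph → Set
HasDoubleEdge G = Σ (V G) λ u → Σ (V G) λ v → u ≢ v × E G u v × E G v u

-- Choose a section s of the quotient map h and consider the retraction f = s ∘ h of H.
-- It is not injective (H' is smaller) and not constant (H' has two vertices), so by
-- endo-triviality f is not an endomorphism: some edge x → y is sent to a non-edge.
-- In a reflexive tournament a non-edge f x ↛ f y means f x ≢ f y and f y → f x,
-- and applying h (with h ∘ f = h) yields the double edge h x ⇄ h y in H'.
module Submission where

open import Defs
open import Data.Nat using (_<_; suc; zero; s≤s)
open import Data.Fin using (Fin; _≟_)
open import Data.Fin.Properties using (all?; ¬∀⟶∃¬; pigeonhole; <⇒≢)
open import Data.Product using (∃₂; _×_; _,_; proj₁; proj₂)
open import Data.Sum using (_⊎_; inj₁; inj₂)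
open import Data.Empty using (⊥-elim)
open import Function using (_∘_)
open import Function.Definitions using (Injective)
open import Relation.Nullary using (¬_; Dec; yes; no)
open import Relation.Nullary.Decidable using (_→-dec_; decidable-stable)
open import Relation.Binary.PropositionalEquality
  using (_≡_; _≢_; refl; sym; trans; cong; subst₂; module ≡-Reasoning)
open ≡-Reasoning

nonEdge⇒reverseEdge : ∀ {G} → IsReflexiveTournament G →
  ∀ {u v} → ¬ E G u v → u ≢ v × E G v u
nonEdge⇒reverseEdge (_ , loop , oneWay) {u} {v} ¬uv with u ≟ v
... | yes refl = ⊥-elim (¬uv (loop u))
... | no u≢v with oneWay u v u≢v
...   | inj₁ (uv , _) = ⊥-elim (¬uv uv)
...   | inj₂ (vu , _) = u≢v , vu

edge? : ∀ {G} → IsReflexiveTournament G → (u v : V G) → Dec (E G u v)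
edge? (_ , loop , oneWay) u v with u ≟ v
... | yes refl = yes (loop u)
... | no u≢v with oneWay u v u≢v
...   | inj₁ (uv , _)  = yes uv
...   | inj₂ (_ , ¬uv) = no ¬uv

isHom-or-counterexample : ∀ {G H} →
  (∀ x y → Dec (E G x y)) → (∀ u v → Dec (E H u v)) → (f : V G → V H) →
  IsHom G H f ⊎ ∃₂ λ x y → E G x y × ¬ E H (f x) (f y)
isHom-or-counterexample {G} {H} E? E′? f = result
  where
  preserved? : ∀ x y → Dec (E G x y → E H (f x) (f y))
  preserved? x y = E? x y →-dec E′? (f x) (f y)

  preservedFrom? : ∀ x → Dec (∀ y → E G x y → E H (f x) (f y))
  preservedFrom? x = all? (preserved? x)

  result : IsHom G H f ⊎ ∃₂ λ x y → E G x y × ¬ E H (f x) (f y)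
  result with all? preservedFrom?
  ... | yes hom = inj₁ hom
  ... | no ¬hom with x , ¬homFrom ← ¬∀⟶∃¬ _ _ preservedFrom? ¬hom
                 with y , ¬preserved ← ¬∀⟶∃¬ _ _ (preserved? x) ¬homFrom =
    inj₂ (x , y , decidable-stable (E? x y) (λ ¬xy → ¬preserved (⊥-elim ∘ ¬xy))
            , λ fxfy → ¬preserved (λ _ → fxfy))

automorphism⇒injective : ∀ {G f} → IsAutomorphism G f → Injective _≡_ _≡_ f
automorphism⇒injective {f = f} (_ , g , g∘f≡id , _) {x} {y} fx≡fy = begin
  x       ≡⟨ sym (g∘f≡id x) ⟩
  g (f x) ≡⟨ cong g fx≡fy ⟩
  g (f y) ≡⟨ g∘f≡id y ⟩
  y       ∎

factorThroughSmaller⇒¬injective : ∀ {m n} → m < n →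
  (h : Fin n → Fin m) (s : Fin m → Fin n) → ¬ Injective _≡_ _≡_ (s ∘ h)
factorThroughSmaller⇒¬injective m<n h s injective
  with i , j , i<j , hi≡hj ← pigeonhole m<n h = <⇒≢ i<j (injective (cong s hi≡hj))

constantRetraction⇒subsingleton : {A B : Set} {h : A → B} {s : B → A} →
  (∀ b → h (s b) ≡ b) → IsConstant (s ∘ h) → (a b : B) → a ≡ b
constantRetraction⇒subsingleton {h = h} {s} h∘s≡id (c , const) a b = begin
  a       ≡⟨ sym (h∘s≡id a) ⟩
  h (s a) ≡⟨ cong h (trans (s≡c a) (sym (s≡c b))) ⟩
  h (s b) ≡⟨ h∘s≡id b ⟩
  b       ∎
  where
  s≡c : ∀ b → s b ≡ c
  s≡c b = trans (cong s (sym (h∘s≡id b))) (const (s b))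

distinctPair : ∀ {m} → 1 < m → ∃₂ λ (a b : Fin m) → a ≢ b
distinctPair {suc zero}    (s≤s ())
distinctPair {suc (suc _)} _ = Fin.zero , Fin.suc Fin.zero , λ ()

lemma13 : (H : Digraph) → IsReflexiveTournament H → IsEndoTrivial H →
    (H' : Digraph) → IsHomomorphicImage H H' →
    1 < size H' → size H' < size H → HasDoubleEdge H'
lemma13 H T endoTrivial H' (h , hom , surjective , _) 1<m m<n = doubleEdge
  where
  s : V H' → V H
  s = proj₁ ∘ surjective
  h∘s≡id : ∀ b → h (s b) ≡ b
  h∘s≡id = proj₂ ∘ surjective

  doubleEdge : HasDoubleEdge H'
  doubleEdge with isHom-or-counterexample (edge? T) (edge? T) (s ∘ h)
  ... | inj₁ retractionHom with endoTrivial (s ∘ h) retractionHom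
  ...   | inj₁ aut = ⊥-elim (factorThroughSmaller⇒¬injective m<n h s (automorphism⇒injective aut))
  ...   | inj₂ constant with a , b , a≢b ← distinctPair 1<m =
    ⊥-elim (a≢b (constantRetraction⇒subsingleton {h = h} {s} h∘s≡id constant a b))
  doubleEdge | inj₂ (x , y , xy , ¬fxfy) with fx≢fy , fyfx ← nonEdge⇒reverseEdge T ¬fxfy =
    h x , h y , fx≢fy ∘ cong s , hom x y xy ,
    subst₂ (E H') (h∘s≡id (h y)) (h∘s≡id (h x)) (hom _ _ fyfx)
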